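{- Let $\mathcal A$ and $\mathcal B$ be labeled combinatorial classes with $\mathcal A=\mathrm{SEQ}(\mathcal B)$, where $\mathcal A$ is gargantuan, and suppose $\mathfrak a_1\neq0$. Let $a\in\mathcal A$ be a uniformly random object of size $n$ and $m$ a positive integer. Then \[ \mathbb P(a\text{ has }m\ \mathrm{SEQ}\text{ -irreducible components})=m\,(n)_{m-1}\,\frac{\mathfrak a_1^{m-1}\mathfrak a_{n-m+1}}{\mathfrak a_n}+O\Big(n^m\frac{\mathfrak a_{n-m}}{\mathfrak a_n}\Big). \]
   Context: A labeled combinatorial class is a collection of objects of finite size $n$ with atoms labeled bijectively by $[n]$, stable under relabeling, with $\mathfrak a_n$ objects of size $n$; EGF $\sum\mathfrak a_nz^n/n!$. For a labeled class $\mathcal B$ with $\mathfrak b_0=0$, $\mathcal B^m$ is the labeled product of $m$ copies (EGF $B(z)^m$) and $\mathrm{SEQ}(\mathcal B)=\sum_{m\ge0}\mathcal B^m$ (EGF $1/(1-B(z))$); an object of $\mathrm{SEQ}(\mathcal B)$ lying in $\mathcal B^m$ has $m$ $\mathrm{SEQ}$-irreducible components. A sequence $(a_n)$ is gargantuan if $a_{n-1}/a_n\to0$ and for every positive integer $r$, $\sum_{k=r}^{n-r}|a_ka_{n-k}|=O(a_{n-r})$; a labeled class is gargantuan if $(\mathfrak a_n/n!)$ is gargantuan. Random objects of size $n$ are uniform. $(n)_k=n(n-1)\cdots(n-k+1)$. -}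

module Defs where

open import Data.Nat as ℕ using (ℕ; zero; suc; _∸_; _≤_; _!)
open import Data.Nat.Combinatorics using (_C_)
open import Data.Integer using (+_)
open import Data.Rational as ℚ using (ℚ; 0ℚ; _/_; ∣_∣)
open import Data.Product using (Σ; _×_)
open import Relation.Binary.PropositionalEquality using (_≡_)
open import Relation.Nullary using (¬_)

sumTo : (ℕ → ℕ) → ℕ → ℕ
sumTo f zero    = f zero
sumTo f (suc n) = sumTo f n ℕ.+ f (suc n)

sumFromℚ : (ℕ → ℚ) → ℕ → ℕ → ℚ
sumFromℚ f lo zero      = 0ℚ
sumFromℚ f lo (suc len) = f lo ℚ.+ sumFromℚ f (suc lo) len

-- Σ_{k=lo}^{hi} f k, empty when hi < lo
sumRangeℚ : (ℕ → ℚ) → ℕ → ℕ → ℚ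
sumRangeℚ f lo hi = sumFromℚ f lo (suc hi ∸ lo)

-- p / d as a rational, with the (unused) convention p / 0 = 0
_⊘_ : ℕ → ℕ → ℚ
p ⊘ zero  = 0ℚ
p ⊘ suc d = (+ p) / suc d

-- Counting sequences of labeled classes: c n = number of objects of size n.
-- Labeled product: (f ⋆ g) n = Σ_k (n choose k) f k g (n-k)   (EGF F(z)G(z))
_⋆_ : (ℕ → ℕ) → (ℕ → ℕ) → (ℕ → ℕ)
(f ⋆ g) n = sumTo (λ k → (n C k) ℕ.* f k ℕ.* g (n ∸ k)) n

unitCount : ℕ → ℕ
unitCount zero    = 1
unitCount (suc _) = 0

powCount : (ℕ → ℕ) → ℕ → (ℕ → ℕ)
powCount b zero    = unitCount
powCount b (suc m) = b ⋆ powCount b m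

-- counting sequence of SEQ(B) = Σ_{m≥0} B^m (EGF 1/(1-B)); when b 0 = 0,
-- B^m has no objects of size n < m, so the sum over m may stop at n.
seqCount : (ℕ → ℕ) → (ℕ → ℕ)
seqCount b n = sumTo (λ m → powCount b m n) n

-- probability that a uniformly random object of size n of SEQ(B)
-- has exactly m SEQ-irreducible components (i.e. lies in B^m)
probComponents : (ℕ → ℕ) → ℕ → ℕ → ℚ
probComponents b m n = powCount b m n ⊘ seqCount b n

normalised : (ℕ → ℕ) → (ℕ → ℚ)
normalised a n = a n ⊘ (n !)

Gargantuan : (ℕ → ℚ) → Set
Gargantuan a =
  ((ε : ℚ) → ℚ.Positive ε →
     Σ ℕ λ N → (n : ℕ) → N ≤ n →
       (¬ (a n ≡ 0ℚ)) × (∣ a (n ∸ 1) ∣ ℚ.≤ ε ℚ.* ∣ a n ∣))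
  ×
  ((r : ℕ) → 1 ≤ r →
     Σ ℚ λ C → Σ ℕ λ N → (n : ℕ) → N ≤ n →
       sumRangeℚ (λ k → ∣ a k ℚ.* a (n ∸ k) ∣) r (n ∸ r) ℚ.≤ C ℚ.* ∣ a (n ∸ r) ∣)

GargantuanClass : (ℕ → ℕ) → Set
GargantuanClass a = Gargantuan (normalised a)

-- Work with the exponential-generating-function coefficients βₙ = 𝔟ₙ/n!,
-- αₙ = 𝔞ₙ/n! and [zⁿ]B(z)ᵐ.  As 𝔟₀ = 0, [zⁿ]Bʲ⁺² is the convolution
-- Σ_{k=1}^{n-j-1} βₖ [zⁿ⁻ᵏ]Bʲ⁺¹: its terms k = 1 and k = n-j-1 produce the
-- main term, and, since β ≤ α and [zⁿ]Bʲ⁺¹ = O(α_{n-j}), the others are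
-- bounded by the gargantuan tail Σ_{k=2}^{n-j-2} αₖ α_{n-j-k} = O(α_{n-j-2}).
-- Induction on j gives [zⁿ]Bʲ⁺¹ = (j+1) β₁ʲ β_{n-j} + O(α_{n-j-1}); from
-- A = 1 + BA, α - β = O(α_{n-1}), so β_{n-j} may be replaced by α_{n-j}.
-- Multiplying by n!/𝔞ₙ (note αₙ ≥ [zⁿ]Bⁿ = β₁ⁿ > 0) and using
-- n! ≤ nᵐ (n-m)! turns this into the statement.
module Submission where

open import Defs
open import Data.Nat as ℕ using (ℕ; zero; suc; _∸_; _≤_; _^_; _!; NonZero)
open import Data.Nat.Combinatorics
  using (_P_; _C_; nPk≡n!/[n∸k]!; k![n∸k]!∣n!; [n∸k]!k!∣n!; [n-k]*[n-k-1]!≡[n-k]!)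
open import Data.Nat.Combinatorics.Specification using (nCk≡n!/k![n-k]!)
import Data.Nat.DivMod as ℕ
import Data.Nat.Divisibility as ℕ
import Data.Nat.Properties as ℕP
open import Data.Rational as ℚ using (ℚ; ∣_∣; 0ℚ; 1ℚ; _+_; _*_; _-_; -_; toℚᵘ)
import Data.Rational.Properties as ℚP
open import Data.Rational.Solver using (module +-*-Solver)
import Data.Rational.Unnormalised as ℚᵘ
import Data.Rational.Unnormalised.Properties as ℚᵘP
import Data.Integer as ℤ
import Data.Integer.Properties as ℤP
import Data.Integer.Solver as ℤSolver
open import Algebra.Definitions.RawSemiring ℚ.+-*-rawSemiring using () renaming (_^_ to _^ℚ_)
open import Data.Empty using (⊥-elim)
open import Data.Product using (Σ; _,_; _×_; proj₂)
open import Data.Sum using (inj₁; inj₂)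
open import Relation.Binary.PropositionalEquality
  using (_≡_; refl; sym; trans; cong; cong₂; subst; subst₂; module ≡-Reasoning)
open import Relation.Nullary using (¬_)

open +-*-Solver using (solve; _:+_; _:*_; _:-_; :-_; _:=_; con)
open ℤSolver.+-*-Solver using () renaming (solve to ℤ-solve; _:+_ to _⊕_; _:*_ to _⊗_; _:=_ to _⊜_; con to ℤcon)

toℚ : ℕ → ℚ
toℚ n = ℤ.+ n ℚ./ 1

toℚᵘ-toℚ : ∀ n → toℚᵘ (toℚ n) ℚᵘ.≃ ℚᵘ.mkℚᵘ (ℤ.+ n) 0
toℚᵘ-toℚ n = ℚP.toℚᵘ-fromℚᵘ (ℚᵘ.mkℚᵘ (ℤ.+ n) 0)

toℚ-+ : ∀ m n → toℚ (m ℕ.+ n) ≡ toℚ m + toℚ n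
toℚ-+ m n = ℚP.toℚᵘ-injective (begin
  toℚᵘ (toℚ (m ℕ.+ n))                        ≈⟨ toℚᵘ-toℚ (m ℕ.+ n) ⟩
  ℚᵘ.mkℚᵘ (ℤ.+ (m ℕ.+ n)) 0                   ≈⟨ ℚᵘ.*≡* cross ⟩
  ℚᵘ.mkℚᵘ (ℤ.+ m) 0 ℚᵘ.+ ℚᵘ.mkℚᵘ (ℤ.+ n) 0    ≈⟨ ℚᵘP.+-cong (toℚᵘ-toℚ m) (toℚᵘ-toℚ n) ⟨
  toℚᵘ (toℚ m) ℚᵘ.+ toℚᵘ (toℚ n)              ≈⟨ ℚP.toℚᵘ-homo-+ (toℚ m) (toℚ n) ⟨
  toℚᵘ (toℚ m + toℚ n)                        ∎)
  where
  open ℚᵘP.≃-Reasoning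
  one : ℤSolver.+-*-Solver.Polynomial 2
  one = ℤcon (ℤ.+ 1)
  cross : ℤ.+ (m ℕ.+ n) ℤ.* (ℤ.+ 1 ℤ.* ℤ.+ 1) ≡ (ℤ.+ m ℤ.* ℤ.+ 1 ℤ.+ ℤ.+ n ℤ.* ℤ.+ 1) ℤ.* ℤ.+ 1
  cross = trans (cong (ℤ._* ℤ.+ 1) (ℤP.pos-+ m n))
                (ℤ-solve 2 (λ x y → (x ⊕ y) ⊗ one ⊜ (x ⊗ one ⊕ y ⊗ one) ⊗ one) refl (ℤ.+ m) (ℤ.+ n))

toℚ-* : ∀ m n → toℚ (m ℕ.* n) ≡ toℚ m * toℚ n
toℚ-* m n = ℚP.toℚᵘ-injective (begin
  toℚᵘ (toℚ (m ℕ.* n))                        ≈⟨ toℚᵘ-toℚ (m ℕ.* n) ⟩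
  ℚᵘ.mkℚᵘ (ℤ.+ (m ℕ.* n)) 0                   ≈⟨ ℚᵘ.*≡* (cong (ℤ._* ℤ.+ 1) (ℤP.pos-* m n)) ⟩
  ℚᵘ.mkℚᵘ (ℤ.+ m) 0 ℚᵘ.* ℚᵘ.mkℚᵘ (ℤ.+ n) 0    ≈⟨ ℚᵘP.*-cong (toℚᵘ-toℚ m) (toℚᵘ-toℚ n) ⟨
  toℚᵘ (toℚ m) ℚᵘ.* toℚᵘ (toℚ n)              ≈⟨ ℚP.toℚᵘ-homo-* (toℚ m) (toℚ n) ⟨
  toℚᵘ (toℚ m * toℚ n)                        ∎)
  where open ℚᵘP.≃-Reasoning

toℚ-*³ : ∀ a b c d → toℚ (a ℕ.* b ℕ.* c ℕ.* d) ≡ toℚ a * toℚ b * toℚ c * toℚ d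
toℚ-*³ a b c d = trans (toℚ-* (a ℕ.* b ℕ.* c) d) (cong (_* toℚ d) (trans (toℚ-* (a ℕ.* b) c) (cong (_* toℚ c) (toℚ-* a b))))

toℚ-nonNeg : ∀ n → 0ℚ ℚ.≤ toℚ n
toℚ-nonNeg n = ℚP.nonNegative⁻¹ (toℚ n) {{ℚP.normalize-nonNeg n 1}}

toℚ-pos : ∀ n .{{_ : NonZero n}} → ℚ.Positive (toℚ n)
toℚ-pos (suc n) = ℚP.normalize-pos (suc n) 1

toℚ-mono-≤ : ∀ {m n} → m ≤ n → toℚ m ℚ.≤ toℚ n
toℚ-mono-≤ {m} {n} m≤n = begin
  toℚ m                ≡⟨ ℚP.+-identityʳ (toℚ m) ⟨
  toℚ m + 0ℚ           ≤⟨ ℚP.+-monoʳ-≤ (toℚ m) (toℚ-nonNeg (n ∸ m)) ⟩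
  toℚ m + toℚ (n ∸ m)  ≡⟨ toℚ-+ m (n ∸ m) ⟨
  toℚ (m ℕ.+ (n ∸ m))  ≡⟨ cong toℚ (ℕP.m+[n∸m]≡n m≤n) ⟩
  toℚ n                ∎
  where open ℚP.≤-Reasoning

toℚ-^ : ∀ m n → toℚ (m ^ n) ≡ toℚ m ^ℚ n
toℚ-^ m zero    = refl
toℚ-^ m (suc n) = trans (toℚ-* m (m ^ n)) (cong (toℚ m *_) (toℚ-^ m n))

toℚ-cancelˡ-≤ : ∀ D .{{_ : NonZero D}} {x y} → toℚ D * x ℚ.≤ toℚ D * y → x ℚ.≤ y
toℚ-cancelˡ-≤ D = ℚP.*-cancelˡ-≤-pos (toℚ D) {{toℚ-pos D}}

toℚ-cancelˡ-≡ : ∀ D .{{_ : NonZero D}} {x y} → toℚ D * x ≡ toℚ D * y → x ≡ y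
toℚ-cancelˡ-≡ D e = ℚP.≤-antisym (toℚ-cancelˡ-≤ D (ℚP.≤-reflexive e)) (toℚ-cancelˡ-≤ D (ℚP.≤-reflexive (sym e)))

toℚ-*-⊘ : ∀ p D .{{_ : NonZero D}} → toℚ D * (p ⊘ D) ≡ toℚ p
toℚ-*-⊘ p (suc d) = ℚP.toℚᵘ-injective (begin
  toℚᵘ (toℚ (suc d) * (p ⊘ suc d))                 ≈⟨ ℚP.toℚᵘ-homo-* (toℚ (suc d)) (p ⊘ suc d) ⟩
  toℚᵘ (toℚ (suc d)) ℚᵘ.* toℚᵘ (p ⊘ suc d)         ≈⟨ ℚᵘP.*-cong (toℚᵘ-toℚ (suc d)) (ℚP.toℚᵘ-fromℚᵘ _) ⟩
  ℚᵘ.mkℚᵘ (ℤ.+ suc d) 0 ℚᵘ.* ℚᵘ.mkℚᵘ (ℤ.+ p) d       ≈⟨ ℚᵘ.*≡* cross ⟩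
  ℚᵘ.mkℚᵘ (ℤ.+ p) 0                                 ≈⟨ toℚᵘ-toℚ p ⟨
  toℚᵘ (toℚ p)                                    ∎)
  where
  open ℚᵘP.≃-Reasoning
  cross : (ℤ.+ suc d ℤ.* ℤ.+ p) ℤ.* ℤ.+ 1 ≡ ℤ.+ p ℤ.* ℤ.+ suc (d ℕ.+ 0)
  cross = trans (ℤ-solve 2 (λ x y → (y ⊗ x) ⊗ ℤcon (ℤ.+ 1) ⊜ x ⊗ y) refl (ℤ.+ p) (ℤ.+ suc d))
                (cong (λ z → ℤ.+ p ℤ.* ℤ.+ suc z) (sym (ℕP.+-identityʳ d)))

⊘-unique : ∀ p D .{{_ : NonZero D}} {y} → toℚ D * y ≡ toℚ p → y ≡ p ⊘ D
⊘-unique p D e = toℚ-cancelˡ-≡ D (trans e (sym (toℚ-*-⊘ p D)))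

⊘-nonNeg : ∀ p D → 0ℚ ℚ.≤ p ⊘ D
⊘-nonNeg p zero    = ℚP.≤-refl
⊘-nonNeg p (suc d) = ℚP.nonNegative⁻¹ (p ⊘ suc d) {{ℚP.normalize-nonNeg p (suc d)}}

⊘-pos : ∀ p D .{{_ : NonZero p}} .{{_ : NonZero D}} → 0ℚ ℚ.< p ⊘ D
⊘-pos (suc p) (suc d) = ℚP.positive⁻¹ (suc p ⊘ suc d) {{ℚP.normalize-pos (suc p) (suc d)}}

0⊘ : ∀ D → 0 ⊘ D ≡ 0ℚ
0⊘ zero    = refl
0⊘ (suc d) = sym (⊘-unique 0 (suc d) (ℚP.*-zeroʳ (toℚ (suc d))))

⊘-+ : ∀ p q D .{{_ : NonZero D}} → (p ℕ.+ q) ⊘ D ≡ p ⊘ D + q ⊘ D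
⊘-+ p q D = sym (⊘-unique (p ℕ.+ q) D (begin
  toℚ D * (p ⊘ D + q ⊘ D)            ≡⟨ ℚP.*-distribˡ-+ (toℚ D) (p ⊘ D) (q ⊘ D) ⟩
  toℚ D * (p ⊘ D) + toℚ D * (q ⊘ D)  ≡⟨ cong₂ _+_ (toℚ-*-⊘ p D) (toℚ-*-⊘ q D) ⟩
  toℚ p + toℚ q                      ≡⟨ toℚ-+ p q ⟨
  toℚ (p ℕ.+ q)                      ∎))
  where open ≡-Reasoning

⊘≡⊘*⊘ : ∀ p F D .{{_ : NonZero F}} .{{_ : NonZero D}} → p ⊘ D ≡ (p ⊘ F) * (F ⊘ D)
⊘≡⊘*⊘ p F D = sym (⊘-unique p D (begin
  toℚ D * ((p ⊘ F) * (F ⊘ D))  ≡⟨ solve 3 (λ d x y → d :* (x :* y) := x :* (d :* y)) refl (toℚ D) (p ⊘ F) (F ⊘ D) ⟩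
  (p ⊘ F) * (toℚ D * (F ⊘ D))  ≡⟨ cong ((p ⊘ F) *_) (toℚ-*-⊘ F D) ⟩
  (p ⊘ F) * toℚ F              ≡⟨ ℚP.*-comm (p ⊘ F) (toℚ F) ⟩
  toℚ F * (p ⊘ F)              ≡⟨ toℚ-*-⊘ p F ⟩
  toℚ p                        ∎))
  where open ≡-Reasoning

⊘-pos⇒nonZero : ∀ p D → 0ℚ ℚ.< p ⊘ D → NonZero p
⊘-pos⇒nonZero zero    D 0<0⊘D = ⊥-elim (ℚP.<-irrefl (sym (0⊘ D)) 0<0⊘D)
⊘-pos⇒nonZero (suc p) D _     = _

*-monoˡ-≤-0≤ : ∀ {r p q} → 0ℚ ℚ.≤ r → p ℚ.≤ q → r * p ℚ.≤ r * q
*-monoˡ-≤-0≤ {r} 0≤r = ℚP.*-monoˡ-≤-nonNeg r {{ℚ.nonNegative 0≤r}}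

*-monoʳ-≤-0≤ : ∀ {r p q} → 0ℚ ℚ.≤ r → p ℚ.≤ q → p * r ℚ.≤ q * r
*-monoʳ-≤-0≤ {r} 0≤r = ℚP.*-monoʳ-≤-nonNeg r {{ℚ.nonNegative 0≤r}}

0≤* : ∀ {p q} → 0ℚ ℚ.≤ p → 0ℚ ℚ.≤ q → 0ℚ ℚ.≤ p * q
0≤* {p} {q} 0≤p 0≤q = ℚP.≤-trans (ℚP.≤-reflexive (sym (ℚP.*-zeroˡ q))) (*-monoʳ-≤-0≤ 0≤q 0≤p)

p≤p+q : ∀ p {q} → 0ℚ ℚ.≤ q → p ℚ.≤ p + q
p≤p+q p {q} 0≤q = subst (ℚ._≤ p + q) (ℚP.+-identityʳ p) (ℚP.+-monoʳ-≤ p 0≤q)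

p≤q+p : ∀ p {q} → 0ℚ ℚ.≤ q → p ℚ.≤ q + p
p≤q+p p {q} 0≤q = subst (ℚ._≤ q + p) (ℚP.+-identityˡ p) (ℚP.+-monoˡ-≤ p 0≤q)

∣r*p∣≡r*∣p∣ : ∀ {r} p → 0ℚ ℚ.≤ r → ∣ r * p ∣ ≡ r * ∣ p ∣
∣r*p∣≡r*∣p∣ {r} p 0≤r = trans (ℚP.∣p*q∣≡∣p∣*∣q∣ r p) (cong (_* ∣ p ∣) (ℚP.0≤p⇒∣p∣≡p 0≤r))

p≤∣p∣ : ∀ p → p ℚ.≤ ∣ p ∣
p≤∣p∣ p@(ℚ.mkℚ (ℤ.+ _)      _ _) = ℚP.≤-refl
p≤∣p∣ p@(ℚ.mkℚ ℤ.-[1+ _ ] _ _) = ℚP.≤-trans (ℚP.<⇒≤ (ℚP.negative⁻¹ p)) (ℚP.0≤∣p∣ p)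

OnRange : ℕ → ℕ → (ℕ → Set) → Set
OnRange lo len P = ∀ k → lo ≤ k → k ℕ.< lo ℕ.+ len → P k

empty-range : ∀ {lo c} → lo ≤ c → ¬ c ℕ.< lo ℕ.+ 0
empty-range {lo} {c} lo≤c c<lo+0 = ℕP.<⇒≱ (subst (c ℕ.<_) (ℕP.+-identityʳ lo) c<lo+0) lo≤c

OnRange-head : ∀ {lo len P} → OnRange lo (suc len) P → P lo
OnRange-head {lo} {len} h = h lo ℕP.≤-refl (ℕP.m<m+n lo (ℕ.s≤s ℕ.z≤n))

OnRange-tail : ∀ {lo len P} → OnRange lo (suc len) P → OnRange (suc lo) len P
OnRange-tail {lo} {len} h k lo<k k<end =
  h k (ℕP.<⇒≤ lo<k) (subst (k ℕ.<_) (sym (ℕP.+-suc lo len)) k<end)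

sumFromℚ-cong : ∀ {f g} lo len → OnRange lo len (λ k → f k ≡ g k) → sumFromℚ f lo len ≡ sumFromℚ g lo len
sumFromℚ-cong lo zero      h = refl
sumFromℚ-cong lo (suc len) h = cong₂ _+_ (OnRange-head h) (sumFromℚ-cong (suc lo) len (OnRange-tail h))

sumFromℚ-mono-≤ : ∀ {f g} lo len → OnRange lo len (λ k → f k ℚ.≤ g k) →
                  sumFromℚ f lo len ℚ.≤ sumFromℚ g lo len
sumFromℚ-mono-≤ lo zero      h = ℚP.≤-refl
sumFromℚ-mono-≤ lo (suc len) h = ℚP.+-mono-≤ (OnRange-head h) (sumFromℚ-mono-≤ (suc lo) len (OnRange-tail h))

sumFromℚ-0ℚ : ∀ lo len → sumFromℚ (λ _ → 0ℚ) lo len ≡ 0ℚ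
sumFromℚ-0ℚ lo zero      = refl
sumFromℚ-0ℚ lo (suc len) = trans (ℚP.+-identityˡ _) (sumFromℚ-0ℚ (suc lo) len)

sumFromℚ-vanishing : ∀ {f} lo len → OnRange lo len (λ k → f k ≡ 0ℚ) → sumFromℚ f lo len ≡ 0ℚ
sumFromℚ-vanishing lo len h = trans (sumFromℚ-cong lo len h) (sumFromℚ-0ℚ lo len)

sumFromℚ-nonNeg : ∀ {f} lo len → OnRange lo len (λ k → 0ℚ ℚ.≤ f k) → 0ℚ ℚ.≤ sumFromℚ f lo len
sumFromℚ-nonNeg {f} lo len h = subst (ℚ._≤ sumFromℚ f lo len) (sumFromℚ-0ℚ lo len) (sumFromℚ-mono-≤ lo len h)

sumFromℚ-+ : ∀ f g lo len → sumFromℚ (λ k → f k + g k) lo len ≡ sumFromℚ f lo len + sumFromℚ g lo len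
sumFromℚ-+ f g lo zero      = refl
sumFromℚ-+ f g lo (suc len) = trans (cong ((f lo + g lo) +_) (sumFromℚ-+ f g (suc lo) len))
  (solve 4 (λ a b c d → (a :+ b) :+ (c :+ d) := (a :+ c) :+ (b :+ d)) refl
     (f lo) (g lo) (sumFromℚ f (suc lo) len) (sumFromℚ g (suc lo) len))

*-sumFromℚ : ∀ c f lo len → c * sumFromℚ f lo len ≡ sumFromℚ (λ k → c * f k) lo len
*-sumFromℚ c f lo zero      = ℚP.*-zeroʳ c
*-sumFromℚ c f lo (suc len) = trans (ℚP.*-distribˡ-+ c (f lo) _) (cong (c * f lo +_) (*-sumFromℚ c f (suc lo) len))

sumFromℚ-++ : ∀ f lo m n → sumFromℚ f lo (m ℕ.+ n) ≡ sumFromℚ f lo m + sumFromℚ f (lo ℕ.+ m) n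
sumFromℚ-++ f lo zero    n = trans (cong (λ z → sumFromℚ f z n) (sym (ℕP.+-identityʳ lo))) (sym (ℚP.+-identityˡ _))
sumFromℚ-++ f lo (suc m) n = begin
  f lo + sumFromℚ f (suc lo) (m ℕ.+ n)                          ≡⟨ cong (f lo +_) (sumFromℚ-++ f (suc lo) m n) ⟩
  f lo + (sumFromℚ f (suc lo) m + sumFromℚ f (suc lo ℕ.+ m) n)  ≡⟨ ℚP.+-assoc (f lo) _ _ ⟨
  sumFromℚ f lo (suc m) + sumFromℚ f (suc lo ℕ.+ m) n           ≡⟨ cong (λ z → sumFromℚ f lo (suc m) + sumFromℚ f z n) (sym (ℕP.+-suc lo m)) ⟩
  sumFromℚ f lo (suc m) + sumFromℚ f (lo ℕ.+ suc m) n           ∎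
  where open ≡-Reasoning

sumFromℚ-snoc : ∀ f lo len → sumFromℚ f lo (suc len) ≡ sumFromℚ f lo len + f (lo ℕ.+ len)
sumFromℚ-snoc f lo len = begin
  sumFromℚ f lo (suc len)                           ≡⟨ cong (sumFromℚ f lo) (ℕP.+-comm 1 len) ⟩
  sumFromℚ f lo (len ℕ.+ 1)                         ≡⟨ sumFromℚ-++ f lo len 1 ⟩
  sumFromℚ f lo len + (f (lo ℕ.+ len) + 0ℚ)         ≡⟨ cong (sumFromℚ f lo len +_) (ℚP.+-identityʳ _) ⟩
  sumFromℚ f lo len + f (lo ℕ.+ len)                ∎
  where open ≡-Reasoning

sumFromℚ-shift : ∀ f lo len → sumFromℚ f (suc lo) len ≡ sumFromℚ (λ k → f (suc k)) lo len
sumFromℚ-shift f lo zero      = refl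
sumFromℚ-shift f lo (suc len) = cong (f (suc lo) +_) (sumFromℚ-shift f (suc lo) len)

sumFromℚ-comm : ∀ (h : ℕ → ℕ → ℚ) lo₁ len₁ lo₂ len₂ →
  sumFromℚ (λ i → sumFromℚ (h i) lo₂ len₂) lo₁ len₁ ≡ sumFromℚ (λ j → sumFromℚ (λ i → h i j) lo₁ len₁) lo₂ len₂
sumFromℚ-comm h lo₁ zero       lo₂ len₂ = sym (sumFromℚ-0ℚ lo₂ len₂)
sumFromℚ-comm h lo₁ (suc len₁) lo₂ len₂ =
  trans (cong (sumFromℚ (h lo₁) lo₂ len₂ +_) (sumFromℚ-comm h (suc lo₁) len₁ lo₂ len₂))
        (sym (sumFromℚ-+ (h lo₁) (λ j → sumFromℚ (λ i → h i j) (suc lo₁) len₁) lo₂ len₂))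

term≤sumFromℚ : ∀ {f} lo len c → lo ≤ c → c ℕ.< lo ℕ.+ len → OnRange lo len (λ k → 0ℚ ℚ.≤ f k) →
                f c ℚ.≤ sumFromℚ f lo len
term≤sumFromℚ lo zero c lo≤c c<lo+0 _ = ⊥-elim (empty-range lo≤c c<lo+0)
term≤sumFromℚ {f} lo (suc len) c lo≤c c<end h with ℕP.m≤n⇒m<n∨m≡n lo≤c
... | inj₂ refl = begin
  f lo                          ≡⟨ ℚP.+-identityʳ (f lo) ⟨
  f lo + 0ℚ                     ≤⟨ ℚP.+-monoʳ-≤ (f lo) (sumFromℚ-nonNeg (suc lo) len (OnRange-tail h)) ⟩
  f lo + sumFromℚ f (suc lo) len ∎
  where open ℚP.≤-Reasoning
... | inj₁ lo<c = begin
  f c                             ≤⟨ term≤sumFromℚ (suc lo) len c lo<c (subst (c ℕ.<_) (ℕP.+-suc lo len) c<end) (OnRange-tail h) ⟩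
  sumFromℚ f (suc lo) len         ≡⟨ ℚP.+-identityˡ _ ⟨
  0ℚ + sumFromℚ f (suc lo) len    ≤⟨ ℚP.+-monoˡ-≤ _ (OnRange-head h) ⟩
  f lo + sumFromℚ f (suc lo) len  ∎
  where open ℚP.≤-Reasoning

sumFromℚ-single : ∀ {f} lo len c → lo ≤ c → c ℕ.< lo ℕ.+ len → OnRange lo len (λ k → ¬ k ≡ c → f k ≡ 0ℚ) →
                  sumFromℚ f lo len ≡ f c
sumFromℚ-single lo zero c lo≤c c<lo+0 _ = ⊥-elim (empty-range lo≤c c<lo+0)
sumFromℚ-single {f} lo (suc len) c lo≤c c<end h with ℕP.m≤n⇒m<n∨m≡n lo≤c
... | inj₂ refl = trans (cong (f lo +_) (sumFromℚ-vanishing (suc lo) len (λ k lo<k k<end → OnRange-tail h k lo<k k<end (ℕP.>⇒≢ lo<k))))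
                        (ℚP.+-identityʳ (f lo))
... | inj₁ lo<c = trans (cong (_+ sumFromℚ f (suc lo) len) (OnRange-head h (ℕP.<⇒≢ lo<c))) (trans (ℚP.+-identityˡ _)
                        (sumFromℚ-single (suc lo) len c lo<c (subst (c ℕ.<_) (ℕP.+-suc lo len) c<end) (OnRange-tail h)))

sumTo-⊘ : ∀ h n D .{{_ : NonZero D}} → sumTo h n ⊘ D ≡ sumFromℚ (λ k → h k ⊘ D) 0 (suc n)
sumTo-⊘ h zero    D = sym (ℚP.+-identityʳ _)
sumTo-⊘ h (suc n) D = begin
  (sumTo h n ℕ.+ h (suc n)) ⊘ D                          ≡⟨ ⊘-+ (sumTo h n) (h (suc n)) D ⟩
  sumTo h n ⊘ D + h (suc n) ⊘ D                          ≡⟨ cong (_+ h (suc n) ⊘ D) (sumTo-⊘ h n D) ⟩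
  sumFromℚ (λ k → h k ⊘ D) 0 (suc n) + h (suc n) ⊘ D    ≡⟨ sumFromℚ-snoc (λ k → h k ⊘ D) 0 (suc n) ⟨
  sumFromℚ (λ k → h k ⊘ D) 0 (suc (suc n))              ∎
  where open ≡-Reasoning

[n∸k]!∣n! : ∀ {n k} → k ≤ n → (n ∸ k) ! ℕ.∣ n !
[n∸k]!∣n! k≤n = ℕ.∣-trans (ℕ.m∣m*n _) ([n∸k]!k!∣n! k≤n)

nPk*[n∸k]!≡n! : ∀ {n k} → k ≤ n → (n P k) ℕ.* (n ∸ k) ! ≡ n !
nPk*[n∸k]!≡n! {n} {k} k≤n =
  trans (cong (ℕ._* (n ∸ k) !) (nPk≡n!/[n∸k]! k≤n)) (ℕ.m/n*n≡m {{(n ∸ k) ℕP.!≢0}} ([n∸k]!∣n! k≤n))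

nCk*k![n∸k]!≡n! : ∀ {n k} → k ≤ n → (n C k) ℕ.* (k ! ℕ.* (n ∸ k) !) ≡ n !
nCk*k![n∸k]!≡n! {n} {k} k≤n =
  trans (cong (ℕ._* (k ! ℕ.* (n ∸ k) !)) (nCk≡n!/k![n-k]! k≤n)) (ℕ.m/n*n≡m {{k ℕP.!* (n ∸ k) !≢0}} (k![n∸k]!∣n! k≤n))

n!≤n^k*[n∸k]! : ∀ n k → k ≤ n → n ! ≤ n ^ k ℕ.* (n ∸ k) !
n!≤n^k*[n∸k]! n zero    _   = ℕP.≤-reflexive (sym (ℕP.+-identityʳ (n !)))
n!≤n^k*[n∸k]! n (suc k) k<n = begin
  n !                               ≤⟨ n!≤n^k*[n∸k]! n k (ℕP.<⇒≤ k<n) ⟩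
  n ^ k ℕ.* (n ∸ k) !               ≡⟨ cong (n ^ k ℕ.*_) ([n-k]*[n-k-1]!≡[n-k]! k<n) ⟨
  n ^ k ℕ.* ((n ∸ k) ℕ.* (n ∸ suc k) !) ≤⟨ ℕP.*-monoʳ-≤ (n ^ k) (ℕP.*-monoˡ-≤ ((n ∸ suc k) !) (ℕP.m∸n≤m n k)) ⟩
  n ^ k ℕ.* (n ℕ.* (n ∸ suc k) !)   ≡⟨ ℕP.*-assoc (n ^ k) n _ ⟨
  n ^ k ℕ.* n ℕ.* (n ∸ suc k) !     ≡⟨ cong (ℕ._* (n ∸ suc k) !) (ℕP.*-comm (n ^ k) n) ⟩
  n ^ suc k ℕ.* (n ∸ suc k) !       ∎
  where open ℕP.≤-Reasoning

toℚ-!-*-normalised : ∀ f n → toℚ (n !) * normalised f n ≡ toℚ (f n)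
toℚ-!-*-normalised f n = toℚ-*-⊘ (f n) (n !) {{n ℕP.!≢0}}

normalised-⋆ : ∀ f g n → normalised (f ⋆ g) n ≡ sumFromℚ (λ k → normalised f k * normalised g (n ∸ k)) 0 (suc n)
normalised-⋆ f g n = trans (sumTo-⊘ _ n (n !) {{n ℕP.!≢0}})
  (sumFromℚ-cong 0 (suc n) (λ k _ k<1+n → sym (term k (ℕP.≤-pred k<1+n))))
  where
  term : ∀ k → k ≤ n → normalised f k * normalised g (n ∸ k) ≡ ((n C k) ℕ.* f k ℕ.* g (n ∸ k)) ⊘ (n !)
  term k k≤n = ⊘-unique _ (n !) {{n ℕP.!≢0}} (begin
    toℚ (n !) * (x * y)
      ≡⟨ cong (λ z → toℚ z * (x * y)) (nCk*k![n∸k]!≡n! k≤n) ⟨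
    toℚ ((n C k) ℕ.* (k ! ℕ.* (n ∸ k) !)) * (x * y)
      ≡⟨ cong (_* (x * y)) (trans (toℚ-* (n C k) _) (cong (toℚ (n C k) *_) (toℚ-* (k !) ((n ∸ k) !)))) ⟩
    (toℚ (n C k) * (toℚ (k !) * toℚ ((n ∸ k) !))) * (x * y)
      ≡⟨ solve 5 (λ c a b x y → (c :* (a :* b)) :* (x :* y) := (c :* (a :* x)) :* (b :* y)) refl
           (toℚ (n C k)) (toℚ (k !)) (toℚ ((n ∸ k) !)) x y ⟩
    (toℚ (n C k) * (toℚ (k !) * x)) * (toℚ ((n ∸ k) !) * y)
      ≡⟨ cong₂ (λ u v → (toℚ (n C k) * u) * v) (toℚ-!-*-normalised f k) (toℚ-!-*-normalised g (n ∸ k)) ⟩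
    (toℚ (n C k) * toℚ (f k)) * toℚ (g (n ∸ k))
      ≡⟨ trans (toℚ-* ((n C k) ℕ.* f k) (g (n ∸ k))) (cong (_* toℚ (g (n ∸ k))) (toℚ-* (n C k) (f k))) ⟨
    toℚ ((n C k) ℕ.* f k ℕ.* g (n ∸ k)) ∎)
    where
    open ≡-Reasoning
    x y : ℚ
    x = normalised f k
    y = normalised g (n ∸ k)

record BigO (f g : ℕ → ℚ) : Set where
  constructor bigO
  field
    constant        : ℚ
    constant-nonNeg : 0ℚ ℚ.≤ constant
    threshold       : ℕ
    bound           : ∀ n → threshold ≤ n → f n ℚ.≤ constant * g n

bigO-offset : ∀ {f g} d K N → 0ℚ ℚ.≤ K → (∀ m → N ≤ m → f (m ℕ.+ d) ℚ.≤ K * g (m ℕ.+ d)) → BigO f g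
bigO-offset {f} {g} d K N 0≤K h = bigO K 0≤K (N ℕ.+ d) λ n N+d≤n →
  subst (λ z → f z ℚ.≤ K * g z) (ℕP.m∸n+n≡m (ℕP.m+n≤o⇒n≤o N N+d≤n)) (h (n ∸ d) (ℕP.m+n≤o⇒m≤o∸n N N+d≤n))

Bounded : (f g : ℕ → ℚ) → Set
Bounded f g = Σ ℚ λ K → 0ℚ ℚ.≤ K × (∀ n → f n ℚ.≤ K * g n)

-- A bound valid for n ≥ N extends to all n once g is positive: finitely many
-- exceptions are absorbed into the constant.
bounded-from : ∀ {f g : ℕ → ℚ} → (∀ n → 0ℚ ℚ.< g n) → ∀ K N → 0ℚ ℚ.≤ K → (∀ n → N ≤ n → f n ℚ.≤ K * g n) →
               Bounded f g
bounded-from g>0 K zero    0≤K h = K , 0≤K , λ n → h n ℕ.z≤n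
bounded-from {f} {g} g>0 K (suc N) 0≤K h = bounded-from {f} {g} g>0 (K + q) N (ℚP.+-mono-≤ 0≤K 0≤q) h′
  where
  instance
    g[N]≢0 : ℚ.NonZero (g N)
    g[N]≢0 = ℚP.pos⇒nonZero (g N) {{ℚ.positive (g>0 N)}}
  q : ℚ
  q = ∣ f N ∣ * ℚ.1/ g N
  0≤q : 0ℚ ℚ.≤ q
  0≤q = 0≤* (ℚP.0≤∣p∣ (f N)) (ℚP.<⇒≤ (ℚP.positive⁻¹ _ {{ℚP.1/pos⇒pos (g N) {{ℚ.positive (g>0 N)}}}}))
  h′ : ∀ n → N ≤ n → f n ℚ.≤ (K + q) * g n
  h′ n N≤n with ℕP.m≤n⇒m<n∨m≡n N≤n
  ... | inj₁ N<n = ℚP.≤-trans (h n N<n) (*-monoʳ-≤-0≤ (ℚP.<⇒≤ (g>0 n)) (p≤p+q K 0≤q))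
  ... | inj₂ refl = begin
    f N                        ≤⟨ p≤∣p∣ (f N) ⟩
    ∣ f N ∣                    ≡⟨ ℚP.*-identityʳ _ ⟨
    ∣ f N ∣ * 1ℚ               ≡⟨ cong (∣ f N ∣ *_) (ℚP.*-inverseˡ (g N)) ⟨
    ∣ f N ∣ * (ℚ.1/ g N * g N) ≡⟨ ℚP.*-assoc ∣ f N ∣ _ (g N) ⟨
    q * g N                    ≤⟨ *-monoʳ-≤-0≤ (ℚP.<⇒≤ (g>0 N)) (p≤q+p q 0≤K) ⟩
    (K + q) * g N              ∎
    where open ℚP.≤-Reasoning

bigO⇒bounded : ∀ {f g : ℕ → ℚ} → (∀ n → 0ℚ ℚ.< g n) → BigO f g → Bounded f g
bigO⇒bounded {f} {g} g>0 (bigO K 0≤K N h) = bounded-from {f} {g} g>0 K N 0≤K h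

n<k+m⇒n∸k<m : ∀ {k n m} → k ≤ n → n ℕ.< k ℕ.+ m → n ∸ k ℕ.< m
n<k+m⇒n∸k<m {k} {n} {m} k≤n n<k+m = ℕP.+-cancelˡ-< k (n ∸ k) m (subst (ℕ._< k ℕ.+ m) (sym (ℕP.m+[n∸m]≡n k≤n)) n<k+m)

∸-comm : ∀ n a b → n ∸ a ∸ b ≡ n ∸ b ∸ a
∸-comm n a b = trans (ℕP.∸-+-assoc n a b) (trans (cong (n ∸_) (ℕP.+-comm a b)) (sym (ℕP.∸-+-assoc n b a)))

m+[1+n]∸n≡1+m : ∀ m n → m ℕ.+ suc n ∸ n ≡ suc m
m+[1+n]∸n≡1+m m n = trans (cong (_∸ n) (ℕP.+-suc m n)) (ℕP.m+n∸n≡m (suc m) n)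

^ℚ-pos : ∀ {x} n → 0ℚ ℚ.< x → 0ℚ ℚ.< x ^ℚ n
^ℚ-pos zero    _   = ℚP.positive⁻¹ 1ℚ
^ℚ-pos {x} (suc n) 0<x = ℚP.positive⁻¹ _ {{ℚP.pos*pos⇒pos x {{ℚ.positive 0<x}} (x ^ℚ n) {{ℚ.positive (^ℚ-pos n 0<x)}}}}

module Coefficients (b : ℕ → ℕ) (b0 : b 0 ≡ 0) where

  β : ℕ → ℚ
  β = normalised b

  β^ : ℕ → ℕ → ℚ
  β^ m = normalised (powCount b m)

  α : ℕ → ℚ
  α = normalised (seqCount b)

  β1 : ℚ
  β1 = β 1

  β-nonNeg : ∀ n → 0ℚ ℚ.≤ β n
  β-nonNeg n = ⊘-nonNeg (b n) (n !)

  β^-nonNeg : ∀ m n → 0ℚ ℚ.≤ β^ m n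
  β^-nonNeg m n = ⊘-nonNeg (powCount b m n) (n !)

  α-nonNeg : ∀ n → 0ℚ ℚ.≤ α n
  α-nonNeg n = ⊘-nonNeg (seqCount b n) (n !)

  β^-suc : ∀ m n → β^ (suc m) n ≡ sumFromℚ (λ k → β k * β^ m (n ∸ k)) 0 (suc n)
  β^-suc m n = normalised-⋆ b (powCount b m) n

  β^-0-suc : ∀ n → β^ 0 (suc n) ≡ 0ℚ
  β^-0-suc n = 0⊘ (suc n !)

  α≡sum-β^ : ∀ n → α n ≡ sumFromℚ (λ m → β^ m n) 0 (suc n)
  α≡sum-β^ n = sumTo-⊘ (λ m → powCount b m n) n (n !) {{n ℕP.!≢0}}

  β0*x≡0 : ∀ x → β 0 * x ≡ 0ℚ
  β0*x≡0 x = trans (cong (λ z → z ⊘ 1 * x) b0) (ℚP.*-zeroˡ x)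

  β^-vanishes : ∀ m n → n ℕ.< m → β^ m n ≡ 0ℚ
  β^-vanishes (suc m) n n<1+m = trans (β^-suc m n) (sumFromℚ-vanishing 0 (suc n) term≡0)
    where
    term≡0 : OnRange 0 (suc n) (λ k → β k * β^ m (n ∸ k) ≡ 0ℚ)
    term≡0 zero    _ _     = β0*x≡0 (β^ m n)
    term≡0 (suc k) _ k<1+n = trans (cong (β (suc k) *_) (β^-vanishes m (n ∸ suc k) n∸[1+k]<m)) (ℚP.*-zeroʳ (β (suc k)))
      where
      n∸[1+k]<m : n ∸ suc k ℕ.< m
      n∸[1+k]<m = n<k+m⇒n∸k<m (ℕP.≤-pred k<1+n) (ℕP.≤-trans n<1+m (ℕ.s≤s (ℕP.m≤n+m m k)))

  β^-diag : ∀ m → β^ m m ≡ β1 ^ℚ m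
  β^-diag zero    = refl
  β^-diag (suc m) = begin
    β^ (suc m) (suc m)                                      ≡⟨ β^-suc m (suc m) ⟩
    sumFromℚ (λ k → β k * β^ m (suc m ∸ k)) 0 (suc (suc m)) ≡⟨ sumFromℚ-single 0 (suc (suc m)) 1 ℕ.z≤n (ℕ.s≤s (ℕ.s≤s ℕ.z≤n)) term≡0 ⟩
    β1 * β^ m m                                             ≡⟨ cong (β1 *_) (β^-diag m) ⟩
    β1 * β1 ^ℚ m                                            ∎
    where
    open ≡-Reasoning
    term≡0 : OnRange 0 (suc (suc m)) (λ k → ¬ k ≡ 1 → β k * β^ m (suc m ∸ k) ≡ 0ℚ)
    term≡0 zero          _ _     _   = β0*x≡0 (β^ m (suc m))
    term≡0 (suc zero)    _ _     k≢1 = ⊥-elim (k≢1 refl)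
    term≡0 (suc (suc k)) _ k<2+m _   = trans
      (cong (β (suc (suc k)) *_) (β^-vanishes m (m ∸ suc k) (ℕP.∸-monoʳ-< (ℕ.s≤s ℕ.z≤n) (ℕP.≤-pred (ℕP.≤-pred k<2+m)))))
      (ℚP.*-zeroʳ (β (suc (suc k))))

  β^-1 : ∀ n → β^ 1 n ≡ β n
  β^-1 n = begin
    β^ 1 n                                       ≡⟨ β^-suc 0 n ⟩
    sumFromℚ (λ k → β k * β^ 0 (n ∸ k)) 0 (suc n) ≡⟨ sumFromℚ-single 0 (suc n) n ℕ.z≤n ℕP.≤-refl term≡0 ⟩
    β n * β^ 0 (n ∸ n)                           ≡⟨ cong (λ z → β n * β^ 0 z) (ℕP.n∸n≡0 n) ⟩
    β n * 1ℚ                                     ≡⟨ ℚP.*-identityʳ (β n) ⟩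
    β n                                          ∎
    where
    open ≡-Reasoning
    term≡0 : OnRange 0 (suc n) (λ k → ¬ k ≡ n → β k * β^ 0 (n ∸ k) ≡ 0ℚ)
    term≡0 k _ k<1+n k≢n = trans (cong (λ z → β k * β^ 0 z) (ℕP.+-∸-assoc 1 (ℕP.≤∧≢⇒< (ℕP.≤-pred k<1+n) k≢n)))
                                 (trans (cong (β k *_) (β^-0-suc (n ∸ suc k))) (ℚP.*-zeroʳ (β k)))

  β^≤α : ∀ m n → β^ m n ℚ.≤ α n
  β^≤α m n with ℕP.≤-<-connex m n
  ... | inj₁ m≤n = subst (β^ m n ℚ.≤_) (sym (α≡sum-β^ n))
                     (term≤sumFromℚ 0 (suc n) m ℕ.z≤n (ℕ.s≤s m≤n) (λ k _ _ → β^-nonNeg k n))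
  ... | inj₂ n<m = subst (ℚ._≤ α n) (sym (β^-vanishes m n n<m)) (α-nonNeg n)

  β≤α : ∀ n → β n ℚ.≤ α n
  β≤α n = subst (ℚ._≤ α n) (β^-1 n) (β^≤α 1 n)

  sum-β^≡α : ∀ n len → n ≤ len → sumFromℚ (λ m → β^ m n) 0 (suc len) ≡ α n
  sum-β^≡α n len n≤len = begin
    sumFromℚ f 0 (suc len)
      ≡⟨ cong (λ l → sumFromℚ f 0 (suc l)) (ℕP.m+[n∸m]≡n n≤len) ⟨
    sumFromℚ f 0 (suc n ℕ.+ (len ∸ n))
      ≡⟨ sumFromℚ-++ f 0 (suc n) (len ∸ n) ⟩
    sumFromℚ f 0 (suc n) + sumFromℚ f (suc n) (len ∸ n)
      ≡⟨ cong₂ _+_ (sym (α≡sum-β^ n)) (sumFromℚ-vanishing (suc n) (len ∸ n) (λ m n<m _ → β^-vanishes m n n<m)) ⟩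
    α n + 0ℚ
      ≡⟨ ℚP.+-identityʳ (α n) ⟩
    α n ∎
    where
    open ≡-Reasoning
    f : ℕ → ℚ
    f m = β^ m n

  α-rec : ∀ n → α (suc n) ≡ sumFromℚ (λ k → β k * α (suc n ∸ k)) 0 (suc (suc n))
  α-rec n = begin
    α N
      ≡⟨ α≡sum-β^ N ⟩
    β^ 0 N + sumFromℚ (λ m → β^ m N) 1 N
      ≡⟨ cong₂ _+_ (β^-0-suc n) (sumFromℚ-shift (λ m → β^ m N) 0 N) ⟩
    0ℚ + sumFromℚ f 0 N
      ≡⟨ trans (ℚP.+-identityˡ (sumFromℚ f 0 N)) (sym (ℚP.+-identityʳ (sumFromℚ f 0 N))) ⟩
    sumFromℚ f 0 N + 0ℚ
      ≡⟨ cong (sumFromℚ f 0 N +_) (β^-vanishes (suc N) N (ℕP.n<1+n N)) ⟨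
    sumFromℚ f 0 N + f N
      ≡⟨ sumFromℚ-snoc f 0 N ⟨
    sumFromℚ f 0 (suc N)
      ≡⟨ sumFromℚ-cong 0 (suc N) (λ m _ _ → β^-suc m N) ⟩
    sumFromℚ (λ m → sumFromℚ (λ k → β k * β^ m (N ∸ k)) 0 (suc N)) 0 (suc N)
      ≡⟨ sumFromℚ-comm (λ m k → β k * β^ m (N ∸ k)) 0 (suc N) 0 (suc N) ⟩
    sumFromℚ (λ k → sumFromℚ (λ m → β k * β^ m (N ∸ k)) 0 (suc N)) 0 (suc N)
      ≡⟨ sumFromℚ-cong 0 (suc N) inner ⟩
    sumFromℚ (λ k → β k * α (N ∸ k)) 0 (suc N) ∎
    where
    open ≡-Reasoning
    N : ℕ
    N = suc n
    f : ℕ → ℚ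
    f m = β^ (suc m) N
    inner : OnRange 0 (suc N) (λ k → sumFromℚ (λ m → β k * β^ m (N ∸ k)) 0 (suc N) ≡ β k * α (N ∸ k))
    inner k _ _ = trans (sym (*-sumFromℚ (β k) (λ m → β^ m (N ∸ k)) 0 (suc N)))
                        (cong (β k *_) (sum-β^≡α (N ∸ k) N (ℕP.m∸n≤m N k)))

  β^-suc-trimmed : ∀ m L → β^ (suc m) (L ℕ.+ m) ≡ sumFromℚ (λ k → β k * β^ m (L ℕ.+ m ∸ k)) 1 L
  β^-suc-trimmed m L = begin
    β^ (suc m) n                                    ≡⟨ β^-suc m n ⟩
    f 0 + sumFromℚ f 1 (L ℕ.+ m)                    ≡⟨ cong₂ _+_ (β0*x≡0 (β^ m n)) (sumFromℚ-++ f 1 L m) ⟩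
    0ℚ + (sumFromℚ f 1 L + sumFromℚ f (suc L) m)    ≡⟨ cong (λ z → 0ℚ + (sumFromℚ f 1 L + z)) (sumFromℚ-vanishing (suc L) m tail≡0) ⟩
    0ℚ + (sumFromℚ f 1 L + 0ℚ)                      ≡⟨ trans (ℚP.+-identityˡ _) (ℚP.+-identityʳ _) ⟩
    sumFromℚ f 1 L                                  ∎
    where
    open ≡-Reasoning
    n : ℕ
    n = L ℕ.+ m
    f : ℕ → ℚ
    f k = β k * β^ m (n ∸ k)
    tail≡0 : OnRange (suc L) m (λ k → f k ≡ 0ℚ)
    tail≡0 k L<k k<1+n = trans (cong (β k *_) (β^-vanishes m (n ∸ k)
      (n<k+m⇒n∸k<m (ℕP.≤-pred k<1+n) (ℕP.+-monoˡ-< m L<k)))) (ℚP.*-zeroʳ (β k))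

  β^-suc-split : ∀ j M → β^ (suc (suc j)) (suc (suc M) ℕ.+ suc j) ≡
    β1 * β^ (suc j) (suc M ℕ.+ suc j) + sumFromℚ (λ k → β k * β^ (suc j) (suc (suc M) ℕ.+ suc j ∸ k)) 2 M
      + β (suc (suc M)) * β1 ^ℚ suc j
  β^-suc-split j M = begin
    β^ (suc (suc j)) n                        ≡⟨ β^-suc-trimmed (suc j) (suc (suc M)) ⟩
    f 1 + sumFromℚ f 2 (suc M)                ≡⟨ cong (f 1 +_) (sumFromℚ-snoc f 2 M) ⟩
    f 1 + (sumFromℚ f 2 M + f (suc (suc M)))  ≡⟨ ℚP.+-assoc (f 1) _ _ ⟨
    f 1 + sumFromℚ f 2 M + f (suc (suc M))    ≡⟨ cong (f 1 + sumFromℚ f 2 M +_) last-term ⟩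
    f 1 + sumFromℚ f 2 M + β (suc (suc M)) * β1 ^ℚ suc j ∎
    where
    open ≡-Reasoning
    n : ℕ
    n = suc (suc M) ℕ.+ suc j
    f : ℕ → ℚ
    f k = β k * β^ (suc j) (n ∸ k)
    last-term : f (suc (suc M)) ≡ β (suc (suc M)) * β1 ^ℚ suc j
    last-term = cong (β (suc (suc M)) *_) (trans (cong (β^ (suc j)) (ℕP.m+n∸m≡n (suc (suc M)) (suc j))) (β^-diag (suc j)))

  leading : ℕ → ℚ
  leading j = toℚ (suc j) * β1 ^ℚ j

  leading-suc : ∀ j → leading (suc j) ≡ β1 * leading j + β1 ^ℚ suc j
  leading-suc j = begin
    toℚ (2 ℕ.+ j) * (β1 * β1 ^ℚ j)         ≡⟨ cong (_* (β1 * β1 ^ℚ j)) (toℚ-+ 1 (suc j)) ⟩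
    (1ℚ + toℚ (suc j)) * (β1 * β1 ^ℚ j)    ≡⟨ solve 3 (λ i x w → (con 1ℚ :+ i) :* (x :* w) := x :* (i :* w) :+ x :* w) refl
                                                  (toℚ (suc j)) β1 (β1 ^ℚ j) ⟩
    β1 * leading j + β1 ^ℚ suc j           ∎
    where open ≡-Reasoning

  seqCount-1 : seqCount b 1 ≡ b 1
  seqCount-1 rewrite b0 = trans (ℕP.*-identityʳ (b 1 ℕ.+ 0)) (ℕP.+-identityʳ (b 1))

  leading*α≡count⊘n! : ∀ j n → j ℕ.< n →
    leading j * α (n ∸ j) ≡ (suc j ℕ.* (n P j) ℕ.* (seqCount b 1 ^ j) ℕ.* seqCount b (n ∸ suc j ℕ.+ 1)) ⊘ (n !)
  leading*α≡count⊘n! j n j<n = ⊘-unique _ (n !) {{n ℕP.!≢0}} (begin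
    toℚ (n !) * (I * W * a)                           ≡⟨ cong (λ z → toℚ z * (I * W * a)) (nPk*[n∸k]!≡n! (ℕP.<⇒≤ j<n)) ⟨
    toℚ ((n P j) ℕ.* (n ∸ j) !) * (I * W * a)         ≡⟨ cong (_* (I * W * a)) (toℚ-* (n P j) ((n ∸ j) !)) ⟩
    toℚ (n P j) * toℚ ((n ∸ j) !) * (I * W * a)       ≡⟨ solve 5 (λ p f i w x → p :* f :* (i :* w :* x) := i :* p :* w :* (f :* x)) refl
                                                           (toℚ (n P j)) (toℚ ((n ∸ j) !)) I W a ⟩
    I * toℚ (n P j) * W * (toℚ ((n ∸ j) !) * a)       ≡⟨ cong₂ (λ u v → I * toℚ (n P j) * u * v) W≡ (toℚ-!-*-normalised (seqCount b) (n ∸ j)) ⟩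
    I * toℚ (n P j) * toℚ (a₁ ^ j) * toℚ (seqCount b (n ∸ j))
      ≡⟨ cong (λ z → I * toℚ (n P j) * toℚ (a₁ ^ j) * toℚ (seqCount b z)) index ⟨
    I * toℚ (n P j) * toℚ (a₁ ^ j) * toℚ (seqCount b (n ∸ suc j ℕ.+ 1))
      ≡⟨ toℚ-*³ (suc j) (n P j) (a₁ ^ j) (seqCount b (n ∸ suc j ℕ.+ 1)) ⟨
    toℚ (suc j ℕ.* (n P j) ℕ.* (a₁ ^ j) ℕ.* seqCount b (n ∸ suc j ℕ.+ 1)) ∎)
    where
    open ≡-Reasoning
    I W a : ℚ
    I = toℚ (suc j)
    W = β1 ^ℚ j
    a = α (n ∸ j)
    a₁ : ℕ
    a₁ = seqCount b 1
    W≡ : W ≡ toℚ (a₁ ^ j)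
    W≡ = sym (trans (cong (λ z → toℚ (z ^ j)) seqCount-1) (toℚ-^ (b 1) j))
    index : n ∸ suc j ℕ.+ 1 ≡ n ∸ j
    index = trans (ℕP.+-comm (n ∸ suc j) 1) (sym (ℕP.+-∸-assoc 1 j<n))

  α[n∸s]≤n^s*a[n∸s]⊘n! : ∀ s n → s ≤ n → α (n ∸ s) ℚ.≤ (n ^ s ℕ.* seqCount b (n ∸ s)) ⊘ (n !)
  α[n∸s]≤n^s*a[n∸s]⊘n! s n s≤n = toℚ-cancelˡ-≤ (n !) {{n ℕP.!≢0}} (begin
    toℚ (n !) * α (n ∸ s)                               ≤⟨ *-monoʳ-≤-0≤ (α-nonNeg (n ∸ s)) (toℚ-mono-≤ (n!≤n^k*[n∸k]! n s s≤n)) ⟩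
    toℚ (n ^ s ℕ.* (n ∸ s) !) * α (n ∸ s)               ≡⟨ cong (_* α (n ∸ s)) (toℚ-* (n ^ s) ((n ∸ s) !)) ⟩
    toℚ (n ^ s) * toℚ ((n ∸ s) !) * α (n ∸ s)           ≡⟨ ℚP.*-assoc (toℚ (n ^ s)) _ _ ⟩
    toℚ (n ^ s) * (toℚ ((n ∸ s) !) * α (n ∸ s))         ≡⟨ cong (toℚ (n ^ s) *_) (toℚ-!-*-normalised (seqCount b) (n ∸ s)) ⟩
    toℚ (n ^ s) * toℚ (seqCount b (n ∸ s))              ≡⟨ toℚ-* (n ^ s) (seqCount b (n ∸ s)) ⟨
    toℚ (n ^ s ℕ.* seqCount b (n ∸ s))                  ≡⟨ toℚ-*-⊘ _ (n !) {{n ℕP.!≢0}} ⟨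
    toℚ (n !) * ((n ^ s ℕ.* seqCount b (n ∸ s)) ⊘ (n !)) ∎)
    where open ℚP.≤-Reasoning

module Asymptotics (b : ℕ → ℕ) (b0 : b 0 ≡ 0) (b1≢0 : ¬ b 1 ≡ 0) (garg : GargantuanClass (seqCount b)) where
  open Coefficients b b0

  β1-pos : 0ℚ ℚ.< β1
  β1-pos = ⊘-pos (b 1) 1 {{ℕ.≢-nonZero b1≢0}}

  α-pos : ∀ n → 0ℚ ℚ.< α n
  α-pos n = ℚP.<-≤-trans (subst (0ℚ ℚ.<_) (sym (β^-diag n)) (^ℚ-pos n β1-pos)) (β^≤α n n)

  convolutionTail : ℕ → ℕ → ℚ
  convolutionTail r n = sumRangeℚ (λ k → α k * α (n ∸ k)) r (n ∸ r)

  convolutionTail-bigO : ∀ r → 1 ≤ r → BigO (convolutionTail r) (λ n → α (n ∸ r))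
  convolutionTail-bigO r 1≤r with proj₂ garg r 1≤r
  ... | C , N , h = bigO ∣ C ∣ (ℚP.0≤∣p∣ C) N λ n N≤n → begin
    convolutionTail r n                             ≡⟨ sumFromℚ-cong r (suc (n ∸ r) ∸ r) (λ k _ _ → sym (ℚP.0≤p⇒∣p∣≡p (0≤α*α n k))) ⟩
    sumRangeℚ (λ k → ∣ α k * α (n ∸ k) ∣) r (n ∸ r) ≤⟨ h n N≤n ⟩
    C * ∣ α (n ∸ r) ∣                               ≤⟨ *-monoʳ-≤-0≤ (ℚP.0≤∣p∣ _) (p≤∣p∣ C) ⟩
    ∣ C ∣ * ∣ α (n ∸ r) ∣                           ≡⟨ cong (∣ C ∣ *_) (ℚP.0≤p⇒∣p∣≡p (α-nonNeg (n ∸ r))) ⟩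
    ∣ C ∣ * α (n ∸ r)                               ∎
    where
    open ℚP.≤-Reasoning
    0≤α*α : ∀ n k → 0ℚ ℚ.≤ α k * α (n ∸ k)
    0≤α*α n k = 0≤* (α-nonNeg k) (α-nonNeg (n ∸ k))

  β*β^≤α*α : ∀ j K → (∀ x → β^ (suc j) x ℚ.≤ K * α (x ∸ j)) →
             ∀ x k → β k * β^ (suc j) (x ∸ k) ℚ.≤ K * (α k * α (x ∸ j ∸ k))
  β*β^≤α*α j K hK x k = begin
    β k * β^ (suc j) (x ∸ k)     ≤⟨ *-monoʳ-≤-0≤ (β^-nonNeg (suc j) (x ∸ k)) (β≤α k) ⟩
    α k * β^ (suc j) (x ∸ k)     ≤⟨ *-monoˡ-≤-0≤ (α-nonNeg k) (hK (x ∸ k)) ⟩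
    α k * (K * α (x ∸ k ∸ j))    ≡⟨ cong (λ z → α k * (K * α z)) (∸-comm x k j) ⟩
    α k * (K * α (x ∸ j ∸ k))    ≡⟨ solve 3 (λ a c y → a :* (c :* y) := c :* (a :* y)) refl (α k) K (α (x ∸ j ∸ k)) ⟩
    K * (α k * α (x ∸ j ∸ k))    ∎
    where open ℚP.≤-Reasoning

  β^-bounded-step : ∀ j → Bounded (β^ (suc j)) (λ n → α (n ∸ j)) → BigO (convolutionTail 1) (λ n → α (n ∸ 1)) →
                    BigO (β^ (suc (suc j))) (λ n → α (n ∸ suc j))
  β^-bounded-step j (K , 0≤K , hK) (bigO K₁ 0≤K₁ N₁ h₁) = bigO-offset (suc j) (K * K₁) N₁ (0≤* 0≤K 0≤K₁) λ L N₁≤L →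
    let x = L ℕ.+ suc j in begin
    β^ (suc (suc j)) x                                  ≡⟨ β^-suc-trimmed (suc j) L ⟩
    sumFromℚ (λ k → β k * β^ (suc j) (x ∸ k)) 1 L      ≤⟨ sumFromℚ-mono-≤ 1 L (λ k _ _ → β*β^≤α*α j K hK x k) ⟩
    sumFromℚ (λ k → K * (α k * α (x ∸ j ∸ k))) 1 L     ≡⟨ *-sumFromℚ K (λ k → α k * α (x ∸ j ∸ k)) 1 L ⟨
    K * sumFromℚ (λ k → α k * α (x ∸ j ∸ k)) 1 L       ≡⟨ cong (λ y → K * sumFromℚ (λ k → α k * α (y ∸ k)) 1 L) (m+[1+n]∸n≡1+m L j) ⟩
    K * convolutionTail 1 (suc L)                      ≤⟨ *-monoˡ-≤-0≤ 0≤K (h₁ (suc L) (ℕP.m≤n⇒m≤1+n N₁≤L)) ⟩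
    K * (K₁ * α L)                                     ≡⟨ ℚP.*-assoc K K₁ (α L) ⟨
    (K * K₁) * α L                                     ≡⟨ cong (λ z → (K * K₁) * α z) (ℕP.m+n∸n≡m L (suc j)) ⟨
    (K * K₁) * α (x ∸ suc j)                           ∎
    where open ℚP.≤-Reasoning

  β^-bounded : ∀ j → Bounded (β^ (suc j)) (λ n → α (n ∸ j))
  β^-bounded zero    = 1ℚ , ℚP.<⇒≤ (ℚP.positive⁻¹ 1ℚ) , λ n →
    subst₂ ℚ._≤_ (sym (β^-1 n)) (sym (ℚP.*-identityˡ (α n))) (β≤α n)
  β^-bounded (suc j) = bigO⇒bounded (λ n → α-pos (n ∸ suc j))
    (β^-bounded-step j (β^-bounded j) (convolutionTail-bigO 1 (ℕ.s≤s ℕ.z≤n)))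

  α-suc≡gap+β : ∀ L → α (suc L) ≡ sumFromℚ (λ k → β k * α (suc L ∸ k)) 1 L + β (suc L)
  α-suc≡gap+β L = begin
    α n                                   ≡⟨ α-rec L ⟩
    f 0 + sumFromℚ f 1 (suc L)            ≡⟨ cong₂ _+_ (β0*x≡0 (α n)) (sumFromℚ-snoc f 1 L) ⟩
    0ℚ + (sumFromℚ f 1 L + f n)           ≡⟨ ℚP.+-identityˡ _ ⟩
    sumFromℚ f 1 L + β n * α (n ∸ n)      ≡⟨ cong (λ z → sumFromℚ f 1 L + β n * α z) (ℕP.n∸n≡0 n) ⟩
    sumFromℚ f 1 L + β n * 1ℚ             ≡⟨ cong (sumFromℚ f 1 L +_) (ℚP.*-identityʳ (β n)) ⟩
    sumFromℚ f 1 L + β n                  ∎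
    where
    open ≡-Reasoning
    n : ℕ
    n = suc L
    f : ℕ → ℚ
    f k = β k * α (n ∸ k)

  β-α-bigO : BigO (λ n → ∣ β n - α n ∣) (λ n → α (n ∸ 1))
  β-α-bigO with convolutionTail-bigO 1 (ℕ.s≤s ℕ.z≤n)
  ... | bigO K₁ 0≤K₁ N₁ h₁ = bigO K₁ 0≤K₁ (suc N₁) bound
    where
    bound : ∀ n → suc N₁ ≤ n → ∣ β n - α n ∣ ℚ.≤ K₁ * α (n ∸ 1)
    bound (suc L) (ℕ.s≤s N₁≤L) = begin
      ∣ β n - α n ∣         ≡⟨ cong (λ z → ∣ β n - z ∣) (α-suc≡gap+β L) ⟩
      ∣ β n - (gap + β n) ∣ ≡⟨ cong ∣_∣ (solve 2 (λ s x → x :- (s :+ x) := :- s) refl gap (β n)) ⟩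
      ∣ - gap ∣             ≡⟨ ℚP.∣-p∣≡∣p∣ gap ⟩
      ∣ gap ∣               ≡⟨ ℚP.0≤p⇒∣p∣≡p (sumFromℚ-nonNeg 1 L (λ k _ _ → 0≤* (β-nonNeg k) (α-nonNeg (n ∸ k)))) ⟩
      gap                   ≤⟨ sumFromℚ-mono-≤ 1 L (λ k _ _ → *-monoʳ-≤-0≤ (α-nonNeg (n ∸ k)) (β≤α k)) ⟩
      convolutionTail 1 n   ≤⟨ h₁ n (ℕP.m≤n⇒m≤1+n N₁≤L) ⟩
      K₁ * α L              ∎
      where
      open ℚP.≤-Reasoning
      n : ℕ
      n = suc L
      gap : ℚ
      gap = sumFromℚ (λ k → β k * α (n ∸ k)) 1 L

  β^-step-error : ∀ j K → (∀ x → β^ (suc j) x ℚ.≤ K * α (x ∸ j)) → ∀ M →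
    ∣ β^ (suc (suc j)) (suc (suc M) ℕ.+ suc j) - leading (suc j) * β (suc (suc M)) ∣ ℚ.≤
      β1 * ∣ β^ (suc j) (suc M ℕ.+ suc j) - leading j * β (suc (suc M)) ∣ + K * convolutionTail 2 (suc (suc (suc M)))
  β^-step-error j K hK M = begin
    ∣ β^ (suc (suc j)) n - leading (suc j) * B ∣  ≡⟨ cong ∣_∣ rearrange ⟩
    ∣ β1 * (X - leading j * B) + S ∣              ≤⟨ ℚP.∣p+q∣≤∣p∣+∣q∣ (β1 * (X - leading j * B)) S ⟩
    ∣ β1 * (X - leading j * B) ∣ + ∣ S ∣          ≡⟨ cong₂ _+_ (∣r*p∣≡r*∣p∣ _ (β-nonNeg 1)) (ℚP.0≤p⇒∣p∣≡p 0≤S) ⟩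
    β1 * ∣ X - leading j * B ∣ + S                ≤⟨ ℚP.+-monoʳ-≤ (β1 * ∣ X - leading j * B ∣) S≤ ⟩
    β1 * ∣ X - leading j * B ∣ + K * convolutionTail 2 (suc (suc (suc M))) ∎
    where
    open ℚP.≤-Reasoning
    n : ℕ
    n = suc (suc M) ℕ.+ suc j
    X B S : ℚ
    X = β^ (suc j) (suc M ℕ.+ suc j)
    B = β (suc (suc M))
    S = sumFromℚ (λ k → β k * β^ (suc j) (n ∸ k)) 2 M
    -- the k = 1 and k = M + 2 terms of the convolution carry the leading term
    rearrange : β^ (suc (suc j)) n - leading (suc j) * B ≡ β1 * (X - leading j * B) + S
    rearrange = trans (cong₂ (λ u v → u - v * B) (β^-suc-split j M) (leading-suc j))
      (solve 6 (λ x₁ x s b c w → x₁ :* x :+ s :+ b :* w :- (x₁ :* c :+ w) :* b := x₁ :* (x :- c :* b) :+ s) refl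
         β1 X S B (leading j) (β1 ^ℚ suc j))
    0≤S : 0ℚ ℚ.≤ S
    0≤S = sumFromℚ-nonNeg 2 M (λ k _ _ → 0≤* (β-nonNeg k) (β^-nonNeg (suc j) (n ∸ k)))
    S≤ : S ℚ.≤ K * convolutionTail 2 (suc (suc (suc M)))
    S≤ = begin
      S                                               ≤⟨ sumFromℚ-mono-≤ 2 M (λ k _ _ → β*β^≤α*α j K hK n k) ⟩
      sumFromℚ (λ k → K * (α k * α (n ∸ j ∸ k))) 2 M  ≡⟨ *-sumFromℚ K (λ k → α k * α (n ∸ j ∸ k)) 2 M ⟨
      K * sumFromℚ (λ k → α k * α (n ∸ j ∸ k)) 2 M    ≡⟨ cong (λ y → K * sumFromℚ (λ k → α k * α (y ∸ k)) 2 M)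
                                                              (m+[1+n]∸n≡1+m (suc (suc M)) j) ⟩
      K * convolutionTail 2 (suc (suc (suc M)))       ∎

  β^-asymp-β-step : ∀ j →
    BigO (λ n → ∣ β^ (suc j) n - leading j * β (n ∸ j) ∣) (λ n → α (n ∸ suc j)) →
    Bounded (β^ (suc j)) (λ n → α (n ∸ j)) → BigO (convolutionTail 2) (λ n → α (n ∸ 2)) →
    BigO (λ n → ∣ β^ (suc (suc j)) n - leading (suc j) * β (n ∸ suc j) ∣) (λ n → α (n ∸ suc (suc j)))
  β^-asymp-β-step j (bigO Kₑ 0≤Kₑ Nₑ hₑ) (K , 0≤K , hK) (bigO K₂ 0≤K₂ N₂ h₂) =
    bigO-offset (suc j) (β1 * Kₑ + K * K₂) (suc (suc (Nₑ ℕ.+ N₂))) (ℚP.+-mono-≤ (0≤* (β-nonNeg 1) 0≤Kₑ) (0≤* 0≤K 0≤K₂)) bound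
    where
    bound : ∀ m → suc (suc (Nₑ ℕ.+ N₂)) ≤ m →
      ∣ β^ (suc (suc j)) (m ℕ.+ suc j) - leading (suc j) * β (m ℕ.+ suc j ∸ suc j) ∣ ℚ.≤
        (β1 * Kₑ + K * K₂) * α (m ℕ.+ suc j ∸ suc (suc j))
    bound (suc (suc M)) (ℕ.s≤s (ℕ.s≤s N≤M)) = begin
      ∣ β^ (suc (suc j)) n - leading (suc j) * β (n ∸ suc j) ∣
        ≡⟨ cong (λ z → ∣ β^ (suc (suc j)) n - leading (suc j) * β z ∣) (ℕP.m+n∸n≡m (suc (suc M)) (suc j)) ⟩
      ∣ β^ (suc (suc j)) n - leading (suc j) * β (suc (suc M)) ∣
        ≤⟨ β^-step-error j K hK M ⟩
      β1 * ∣ β^ (suc j) x - leading j * β (suc (suc M)) ∣ + K * convolutionTail 2 (suc (suc (suc M)))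
        ≤⟨ ℚP.+-mono-≤ (*-monoˡ-≤-0≤ (β-nonNeg 1) previous) (*-monoˡ-≤-0≤ 0≤K (h₂ (suc (suc (suc M))) N₂≤)) ⟩
      β1 * (Kₑ * α (suc M)) + K * (K₂ * α (suc M))
        ≡⟨ solve 5 (λ x a k c y → x :* (a :* y) :+ k :* (c :* y) := (x :* a :+ k :* c) :* y) refl β1 Kₑ K K₂ (α (suc M)) ⟩
      (β1 * Kₑ + K * K₂) * α (suc M)
        ≡⟨ cong (λ z → (β1 * Kₑ + K * K₂) * α z) (ℕP.m+n∸n≡m (suc M) (suc j)) ⟨
      (β1 * Kₑ + K * K₂) * α (n ∸ suc (suc j)) ∎
      where
      open ℚP.≤-Reasoning
      n x : ℕ
      n = suc (suc M) ℕ.+ suc j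
      x = suc M ℕ.+ suc j
      previous : ∣ β^ (suc j) x - leading j * β (suc (suc M)) ∣ ℚ.≤ Kₑ * α (suc M)
      previous = subst₂ (λ u v → ∣ β^ (suc j) x - leading j * β u ∣ ℚ.≤ Kₑ * α v)
        (m+[1+n]∸n≡1+m (suc M) j) (ℕP.m+n∸n≡m (suc M) (suc j))
        (hₑ x (ℕP.≤-trans (ℕP.m≤m+n Nₑ N₂) (ℕP.≤-trans N≤M (ℕP.≤-trans (ℕP.n≤1+n M) (ℕP.m≤m+n (suc M) (suc j))))))
      N₂≤ : N₂ ≤ suc (suc (suc M))
      N₂≤ = ℕP.≤-trans (ℕP.m≤n+m N₂ Nₑ) (ℕP.≤-trans N≤M (ℕP.m≤n+m M 3))

  β^-asymp-β : ∀ j → BigO (λ n → ∣ β^ (suc j) n - leading j * β (n ∸ j) ∣) (λ n → α (n ∸ suc j))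
  β^-asymp-β zero    = bigO 0ℚ ℚP.≤-refl 0 λ n _ → ℚP.≤-reflexive (begin
    ∣ β^ 1 n - leading 0 * β n ∣ ≡⟨ cong (λ z → ∣ z - leading 0 * β n ∣) (β^-1 n) ⟩
    ∣ β n - 1ℚ * 1ℚ * β n ∣      ≡⟨ cong ∣_∣ (solve 1 (λ x → x :- con 1ℚ :* con 1ℚ :* x := con 0ℚ) refl (β n)) ⟩
    0ℚ                           ≡⟨ ℚP.*-zeroˡ (α (n ∸ 1)) ⟨
    0ℚ * α (n ∸ 1)               ∎)
    where open ≡-Reasoning
  β^-asymp-β (suc j) = β^-asymp-β-step j (β^-asymp-β j) (β^-bounded j) (convolutionTail-bigO 2 (ℕ.s≤s ℕ.z≤n))

  β^-asymp-α : ∀ j → BigO (λ n → ∣ β^ (suc j) n - leading j * α (n ∸ j) ∣) (λ n → α (n ∸ suc j))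
  β^-asymp-α j with β^-asymp-β j | β-α-bigO
  ... | bigO Kₑ 0≤Kₑ Nₑ hₑ | bigO K₁ 0≤K₁ N₁ h₁ =
    bigO (Kₑ + c * K₁) (ℚP.+-mono-≤ 0≤Kₑ (0≤* 0≤c 0≤K₁)) (Nₑ ℕ.+ (N₁ ℕ.+ j)) bound
    where
    c : ℚ
    c = leading j
    0≤c : 0ℚ ℚ.≤ c
    0≤c = 0≤* (toℚ-nonNeg (suc j)) (ℚP.<⇒≤ (^ℚ-pos j β1-pos))
    bound : ∀ n → Nₑ ℕ.+ (N₁ ℕ.+ j) ≤ n → ∣ β^ (suc j) n - c * α (n ∸ j) ∣ ℚ.≤ (Kₑ + c * K₁) * α (n ∸ suc j)
    bound n N≤n = begin
      ∣ X - c * A ∣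
        ≡⟨ cong ∣_∣ (solve 4 (λ p c x y → p :- c :* y := (p :- c :* x) :+ c :* (x :- y)) refl X c B A) ⟩
      ∣ (X - c * B) + c * (B - A) ∣
        ≤⟨ ℚP.∣p+q∣≤∣p∣+∣q∣ (X - c * B) (c * (B - A)) ⟩
      ∣ X - c * B ∣ + ∣ c * (B - A) ∣
        ≡⟨ cong (∣ X - c * B ∣ +_) (∣r*p∣≡r*∣p∣ (B - A) 0≤c) ⟩
      ∣ X - c * B ∣ + c * ∣ B - A ∣
        ≤⟨ ℚP.+-mono-≤ (hₑ n (ℕP.m+n≤o⇒m≤o Nₑ N≤n)) (*-monoˡ-≤-0≤ 0≤c (h₁ (n ∸ j) N₁≤n∸j)) ⟩
      Kₑ * α (n ∸ suc j) + c * (K₁ * α (n ∸ j ∸ 1))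
        ≡⟨ cong (λ z → Kₑ * α (n ∸ suc j) + c * (K₁ * α z)) (trans (ℕP.∸-+-assoc n j 1) (cong (n ∸_) (ℕP.+-comm j 1))) ⟩
      Kₑ * α (n ∸ suc j) + c * (K₁ * α (n ∸ suc j))
        ≡⟨ solve 4 (λ e c k y → e :* y :+ c :* (k :* y) := (e :+ c :* k) :* y) refl Kₑ c K₁ (α (n ∸ suc j)) ⟩
      (Kₑ + c * K₁) * α (n ∸ suc j) ∎
      where
      open ℚP.≤-Reasoning
      X A B : ℚ
      X = β^ (suc j) n
      A = α (n ∸ j)
      B = β (n ∸ j)
      N₁≤n∸j : N₁ ≤ n ∸ j
      N₁≤n∸j = ℕP.m+n≤o⇒m≤o∸n N₁ (ℕP.m+n≤o⇒n≤o Nₑ N≤n)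

  ratio : ℕ → ℚ
  ratio n = (n !) ⊘ seqCount b n

  ratio-nonNeg : ∀ n → 0ℚ ℚ.≤ ratio n
  ratio-nonNeg n = ⊘-nonNeg (n !) (seqCount b n)

  ⊘a≡⊘n!*ratio : ∀ x n → x ⊘ seqCount b n ≡ (x ⊘ (n !)) * ratio n
  ⊘a≡⊘n!*ratio x n = ⊘≡⊘*⊘ x (n !) (seqCount b n) {{n ℕP.!≢0}} {{⊘-pos⇒nonZero (seqCount b n) (n !) (α-pos n)}}

  probComponents-deviation : ∀ j n → j ℕ.< n →
    ∣ probComponents b (suc j) n -
      (suc j ℕ.* (n P j) ℕ.* (seqCount b 1 ^ j) ℕ.* seqCount b (n ∸ suc j ℕ.+ 1)) ⊘ seqCount b n ∣
      ≡ ∣ β^ (suc j) n - leading j * α (n ∸ j) ∣ * ratio n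
  probComponents-deviation j n j<n = begin
    ∣ probComponents b (suc j) n - main ⊘ seqCount b n ∣
      ≡⟨ cong₂ (λ u v → ∣ u - v ∣) (⊘a≡⊘n!*ratio (powCount b (suc j) n) n)
                                   (trans (⊘a≡⊘n!*ratio main n) (cong (_* ratio n) (sym (leading*α≡count⊘n! j n j<n)))) ⟩
    ∣ β^ (suc j) n * ratio n - leading j * α (n ∸ j) * ratio n ∣
      ≡⟨ cong ∣_∣ (solve 3 (λ p q r → p :* r :- q :* r := r :* (p :- q)) refl (β^ (suc j) n) (leading j * α (n ∸ j)) (ratio n)) ⟩
    ∣ ratio n * (β^ (suc j) n - leading j * α (n ∸ j)) ∣
      ≡⟨ ∣r*p∣≡r*∣p∣ (β^ (suc j) n - leading j * α (n ∸ j)) (ratio-nonNeg n) ⟩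
    ratio n * ∣ β^ (suc j) n - leading j * α (n ∸ j) ∣
      ≡⟨ ℚP.*-comm (ratio n) _ ⟩
    ∣ β^ (suc j) n - leading j * α (n ∸ j) ∣ * ratio n ∎
    where
    open ≡-Reasoning
    main : ℕ
    main = suc j ℕ.* (n P j) ℕ.* (seqCount b 1 ^ j) ℕ.* seqCount b (n ∸ suc j ℕ.+ 1)

  α*ratio≤n^s*a⊘a : ∀ K s n → 0ℚ ℚ.≤ K → s ≤ n →
    K * α (n ∸ s) * ratio n ℚ.≤ K * ((n ^ s ℕ.* seqCount b (n ∸ s)) ⊘ seqCount b n)
  α*ratio≤n^s*a⊘a K s n 0≤K s≤n = begin
    K * α (n ∸ s) * ratio n         ≤⟨ *-monoʳ-≤-0≤ (ratio-nonNeg n) (*-monoˡ-≤-0≤ 0≤K (α[n∸s]≤n^s*a[n∸s]⊘n! s n s≤n)) ⟩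
    K * (error ⊘ (n !)) * ratio n   ≡⟨ ℚP.*-assoc K (error ⊘ (n !)) (ratio n) ⟩
    K * ((error ⊘ (n !)) * ratio n) ≡⟨ cong (K *_) (⊘a≡⊘n!*ratio error n) ⟨
    K * (error ⊘ seqCount b n)      ∎
    where
    open ℚP.≤-Reasoning
    error : ℕ
    error = n ^ s ℕ.* seqCount b (n ∸ s)

  probComponents-asymp : ∀ j → Σ ℚ λ C → Σ ℕ λ N → (n : ℕ) → N ≤ n →
    ∣ probComponents b (suc j) n -
      (suc j ℕ.* (n P j) ℕ.* (seqCount b 1 ^ j) ℕ.* seqCount b (n ∸ suc j ℕ.+ 1)) ⊘ seqCount b n ∣
    ℚ.≤ C * ((n ^ suc j ℕ.* seqCount b (n ∸ suc j)) ⊘ seqCount b n)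
  probComponents-asymp j = constant , threshold ℕ.+ suc j , λ n N+j<n → begin
    ∣ probComponents b (suc j) n -
      (suc j ℕ.* (n P j) ℕ.* (seqCount b 1 ^ j) ℕ.* seqCount b (n ∸ suc j ℕ.+ 1)) ⊘ seqCount b n ∣
      ≡⟨ probComponents-deviation j n (ℕP.m+n≤o⇒n≤o threshold N+j<n) ⟩
    ∣ β^ (suc j) n - leading j * α (n ∸ j) ∣ * ratio n
      ≤⟨ *-monoʳ-≤-0≤ (ratio-nonNeg n) (bound n (ℕP.m+n≤o⇒m≤o threshold N+j<n)) ⟩
    constant * α (n ∸ suc j) * ratio n
      ≤⟨ α*ratio≤n^s*a⊘a constant (suc j) n constant-nonNeg (ℕP.m+n≤o⇒n≤o threshold N+j<n) ⟩
    constant * ((n ^ suc j ℕ.* seqCount b (n ∸ suc j)) ⊘ seqCount b n) ∎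
    where
    open ℚP.≤-Reasoning
    open BigO (β^-asymp-α j)

corollary3p2 : (b : ℕ → ℕ) → b 0 ≡ 0 →
  GargantuanClass (seqCount b) → ¬ (seqCount b 1 ≡ 0) →
  (m : ℕ) → 1 ≤ m →
  Σ ℚ λ C → Σ ℕ λ N → (n : ℕ) → N ≤ n →
    ∣ probComponents b m n ℚ.-
      (m ℕ.* (n P (m ∸ 1)) ℕ.* (seqCount b 1 ^ (m ∸ 1)) ℕ.* seqCount b (n ∸ m ℕ.+ 1))
        ⊘ seqCount b n ∣
    ℚ.≤ C ℚ.* ((n ^ m ℕ.* seqCount b (n ∸ m)) ⊘ seqCount b n)
corollary3p2 b b0 garg a₁≢0 (suc j) _ = probComponents-asymp j
  where open Asymptotics b b0 (λ b₁≡0 → a₁≢0 (trans (Coefficients.seqCount-1 b b0) b₁≡0)) garg
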